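{- Let $\mathbb{F}_q$ be a finite field, let $d\geq 1$, and fix a conjugacy class $C\subset \mathrm{GL}_d(\mathbb{F}_q)$. For $n\geq d$ and $T\in \mathrm{GL}_n(\mathbb{F}_q)$ let $$X_C(T)=\#\{W\leq \mathbb{F}_q^n \mid \dim W=d,\ T(W)=W,\ T|_W\in C\}.$$ Then for $T$ chosen uniformly at random from $\mathrm{GL}_n(\mathbb{F}_q)$, the expectation $\mathbb{E}_{\mathrm{GL}_n(\mathbb{F}_q)}[X_C]$ is independent of $n$ for all $n\geq d$, and equals $\frac{|C|}{|\mathrm{GL}_d(\mathbb{F}_q)|}$.
   Context: The condition $T|_W\in C$ means: for some (equivalently any) linear isomorphism $\iota:\mathbb{F}_q^d\to W$, the matrix of $\iota^{ -1}\circ T|_W\circ\iota$ lies in $C$; this is well defined since $C$ is a conjugacy class. -}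

module Defs where

open import Level using (0ℓ)
open import Data.Nat as ℕ using (ℕ; zero; suc)
open import Data.Bool using (Bool; true; false)
open import Data.Fin as Fin using (Fin)
open import Data.Fin.Properties using () renaming (any? to finAny?)
open import Data.Vec as V using (Vec; []; _∷_)
open import Data.Vec.Properties using (≡-dec)
open import Data.List as L using (List; []; _∷_; length; filter; concatMap)
open import Data.Nat.ListAction using (sum)
open import Data.List.Membership.Propositional using (_∈_)
open import Data.List.Relation.Unary.Any as Any using (Any)
open import Data.List.Relation.Unary.Unique.Propositional using (Unique)
open import Data.Product using (Σ; ∃; _×_; _,_; proj₁; proj₂)
open import Function using (_∘_)
open import Relation.Nullary using (Dec; yes; no; ¬_; does)
open import Relation.Nullary.Decidable using (map′; _×-dec_; _→-dec_; ¬?; decidable-stable)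
open import Relation.Unary using (Pred; Decidable)
open import Relation.Binary.PropositionalEquality using (_≡_; _≢_; refl; subst)
open import Relation.Binary.Definitions using (DecidableEquality)
open import Algebra.Core using (Op₁; Op₂)
open import Algebra.Structures using (IsCommutativeRing)

record FiniteField : Set₁ where
  infixl 6 _+_
  infixl 7 _*_
  field
    Carrier           : Set
    _+_ _*_           : Op₂ Carrier
    -_                : Op₁ Carrier
    0# 1#             : Carrier
    isCommutativeRing : IsCommutativeRing _≡_ _+_ _*_ -_ 0# 1#
    0≢1               : 0# ≢ 1#
    inverse           : ∀ x → x ≢ 0# → ∃ λ y → x * y ≡ 1#
    _≟_               : DecidableEquality Carrier
    elems             : List Carrier
    complete          : ∀ x → x ∈ elems
    unique            : Unique elems

Searchable : Set → Set₁
Searchable A = ∀ {P : Pred A 0ℓ} → Decidable P → Dec (∃ P)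

searchList : {A : Set} (xs : List A) → (∀ x → x ∈ xs) → Searchable A
searchList xs cmp {P} P? =
  map′ Any.satisfied
       (λ { (x , p) → Any.map (λ { refl → p }) (cmp x) })
       (Any.any? P? xs)

searchVec : {A : Set} → Searchable A → ∀ n → Searchable (Vec A n)
searchVec sA zero    P? with P? []
... | yes p = yes ([] , p)
... | no ¬p = no λ { ([] , p) → ¬p p }
searchVec sA (suc n) {P} P? =
  map′ (λ { (x , xs , p) → (x ∷ xs) , p })
       (λ { ((x ∷ xs) , p) → x , xs , p })
       (sA (λ x → searchVec sA n (λ xs → P? (x ∷ xs))))

forall? : {A : Set} → Searchable A → {P : Pred A 0ℓ} → Decidable P → Dec (∀ x → P x)
forall? sA P? =
  map′ (λ ¬∃ x → decidable-stable (P? x) (λ ¬p → ¬∃ (x , ¬p)))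
       (λ ∀p → λ { (x , ¬p) → ¬p (∀p x) })
       (¬? (sA (¬? ∘ P?)))

allVecs : {A : Set} → List A → ∀ n → List (Vec A n)
allVecs xs zero    = [] ∷ []
allVecs xs (suc n) = concatMap (λ x → L.map (x ∷_) (allVecs xs n)) xs

count : {A : Set} {P : Pred A 0ℓ} → Decidable P → List A → ℕ
count P? xs = length (filter P? xs)

infix 3 _⇔_
_⇔_ : Set → Set → Set
A ⇔ B = (A → B) × (B → A)

_⇔-dec_ : {A B : Set} → Dec A → Dec B → Dec (A ⇔ B)
a? ⇔-dec b? = (a? →-dec b?) ×-dec (b? →-dec a?)

module LinAlg (F : FiniteField) where
  open FiniteField F public

  Vect : ℕ → Set
  Vect n = Vec Carrier n

  -- m × n matrices, as a vector of m rows of length n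
  Mat : ℕ → ℕ → Set
  Mat m n = Vec (Vec Carrier n) m

  searchK : Searchable Carrier
  searchK = searchList elems complete

  searchVect : ∀ n → Searchable (Vect n)
  searchVect = searchVec searchK

  searchMat : ∀ m n → Searchable (Mat m n)
  searchMat m n = searchVec (searchVect n) m

  vect? : ∀ {n} → DecidableEquality (Vect n)
  vect? = ≡-dec _≟_

  mat? : ∀ {m n} → DecidableEquality (Mat m n)
  mat? = ≡-dec vect?

  allVects : ∀ n → List (Vect n)
  allVects = allVecs elems

  allMats : ∀ m n → List (Mat m n)
  allMats m n = allVecs (allVects n) m

  zeroV : ∀ n → Vect n
  zeroV n = V.replicate n 0#

  dot : ∀ {n} → Vect n → Vect n → Carrier
  dot u v = V.foldr _ _+_ 0# (V.zipWith _*_ u v)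

  infixr 7 _·_ _⊗_
  _·_ : ∀ {m n} → Mat m n → Vect n → Vect m
  A · v = V.map (λ row → dot row v) A

  _⊗_ : ∀ {m n k} → Mat m n → Mat n k → Mat m k
  A ⊗ B = V.map (λ row → V.map (λ col → dot row col) (V.transpose B)) A

  idMat : ∀ n → Mat n n
  idMat n = V.tabulate (λ i → V.tabulate (λ j →
              Data.Bool.if does (i Fin.≟ j) then 1# else 0#))

  Invertible : ∀ {n} → Mat n n → Set
  Invertible {n} T = ∃ λ S → (T ⊗ S ≡ idMat n) × (S ⊗ T ≡ idMat n)

  invertible? : ∀ {n} → Decidable (Invertible {n})
  invertible? {n} T = searchMat n n (λ S → mat? (T ⊗ S) (idMat n) ×-dec mat? (S ⊗ T) (idMat n))

  InClass : ∀ {d} → Mat d d → Mat d d → Set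
  InClass {d} A₀ A = ∃ λ g → ∃ λ h →
    (g ⊗ h ≡ idMat d) × (h ⊗ g ≡ idMat d) × (A ≡ (g ⊗ A₀) ⊗ h)

  inClass? : ∀ {d} (A₀ : Mat d d) → Decidable (InClass A₀)
  inClass? {d} A₀ A = searchMat d d (λ g → searchMat d d (λ h →
    mat? (g ⊗ h) (idMat d) ×-dec mat? (h ⊗ g) (idMat d) ×-dec mat? A ((g ⊗ A₀) ⊗ h)))

  cardGL : ℕ → ℕ
  cardGL n = count (invertible? {n}) (allMats n n)

  cardClass : ∀ {d} → Mat d d → ℕ
  cardClass {d} A₀ = count (inClass? A₀) (allMats d d)

  -- Subsets of F^n: a Boolean vector indexed by the enumeration allVects n.

  N : ℕ → ℕ
  N n = length (allVects n)

  SubsetV : ℕ → Set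
  SubsetV n = Vec Bool (N n)

  allSubsets : ∀ n → List (SubsetV n)
  allSubsets n = allVecs (true ∷ false ∷ []) (N n)

  infix 4 _∈W_
  _∈W_ : ∀ {n} → Vect n → SubsetV n → Set
  _∈W_ {n} v W = ∃ λ (i : Fin (N n)) → (L.lookup (allVects n) i ≡ v) × (V.lookup W i ≡ true)

  ∈W? : ∀ {n} (v : Vect n) (W : SubsetV n) → Dec (v ∈W W)
  ∈W? {n} v W = finAny? (λ i → vect? (L.lookup (allVects n) i) v ×-dec Data.Bool._≟_ (V.lookup W i) true)

  -- W is a d-dimensional subspace of F^n with T(W) = W and T|_W ∈ C,
  -- where C is the conjugacy class of A₀.  "dim W = d" means W is the
  -- image of an injective linear map ι : F^d → F^n, and "T|_W ∈ C" means
  -- that for such an ι the matrix of ι⁻¹ ∘ T|_W ∘ ι (the unique A with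
  -- T ι = ι A) lies in C.
  Good : ∀ {n d} → Mat d d → Mat n n → SubsetV n → Set
  Good {n} {d} A₀ T W =
    (∀ (v : Vect n) → v ∈W W ⇔ (∃ λ u → (u ∈W W) × (T · u ≡ v)))
    × (∃ λ (ι : Mat n d) →
         (∀ (x : Vect d) → ι · x ≡ zeroV n → x ≡ zeroV d)
       × (∀ (v : Vect n) → v ∈W W ⇔ (∃ λ x → ι · x ≡ v))
       × (∃ λ (A : Mat d d) → InClass A₀ A × (T ⊗ ι ≡ ι ⊗ A)))

  good? : ∀ {n d} (A₀ : Mat d d) (T : Mat n n) → Decidable (Good A₀ T)
  good? {n} {d} A₀ T W =
    forall? (searchVect n) (λ v → ∈W? v W ⇔-dec
       searchVect n (λ u → ∈W? u W ×-dec vect? (T · u) v))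
    ×-dec searchMat n d (λ ι →
       forall? (searchVect d) (λ x → vect? (ι · x) (zeroV n) →-dec vect? x (zeroV d))
       ×-dec forall? (searchVect n) (λ v → ∈W? v W ⇔-dec searchVect d (λ x → vect? (ι · x) v))
       ×-dec searchMat d d (λ A → inClass? A₀ A ×-dec mat? (T ⊗ ι) (ι ⊗ A)))

  X : ∀ {n d} → Mat d d → Mat n n → ℕ
  X {n} A₀ T = count (good? A₀ T) (allSubsets n)

  sumX : ∀ {d} → Mat d d → ℕ → ℕ
  sumX A₀ n = sum (L.map (X A₀) (filter (invertible? {n}) (allMats n n)))

module Submission where

-- Double count the pairs (T, ι) of an invertible T : F^n → F^n and an injective
-- ι : F^d → F^n with T ι = ι A for some A ∈ C.  Grouping them by (T, im ι) gives
-- Σ_T X_C(T) · |GL_d|, since the injective maps with a given image form one free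
-- GL_d-orbit.  Grouping them by A gives |C| times the number of pairs with
-- T ι = ι A₀, because A = u A₀ u⁻¹ is absorbed by replacing ι with ι u.  Finally,
-- every injective ι extends to an invertible matrix, so GL_n acts transitively on
-- injective maps F^d → F^n; hence each ι admits the same number s of T with
-- T ι = ι A₀ (a coset of the stabiliser of ι), and |GL_n| is likewise the number
-- of injective maps times s.

open import Defs
open import Data.Nat using (ℕ; _≤_)

module Counting where

  open import Level using (0ℓ)
  open import Data.Bool as Bool using (Bool; true; false)
  open import Data.Nat using (zero; suc; _+_; _*_; _^_; z≤n; s≤s)
  open import Data.Nat.Properties using (≤-antisym; +-commutativeSemigroup)
  open import Data.Nat.ListAction using (sum)
  open import Data.List using (List; []; _∷_; length; map; filter; _++_; concatMap; cartesianProductWith; cartesianProduct)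
  open import Data.List.Properties using (length-++; length-map; filter-++; filter-≐; filter-none; map-cong; length-removeAt′)
  open import Data.List.Membership.Propositional using (_∈_)
  open import Data.List.Membership.Propositional.Properties using (∈-map⁻; ∈-filter⁺; ∈-filter⁻; ∈-cartesianProductWith⁺; ∈-cartesianProduct⁺)
  open import Data.List.Relation.Unary.Any using (here; there; _─_)
  open import Data.List.Relation.Unary.All as All using (All; []; _∷_)
  open import Data.List.Relation.Unary.All.Properties using (all-filter)
  open import Data.List.Relation.Unary.AllPairs using ([]; _∷_)
  open import Data.List.Relation.Unary.Unique.Propositional using (Unique)
  open import Data.List.Relation.Unary.Unique.Propositional.Properties using (filter⁺; cartesianProductWith⁺; cartesianProduct⁺)
  open import Data.Product using (_×_; _,_; proj₁; proj₂)
  open import Data.Product.Properties using (≡-dec)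
  open import Data.Vec using (Vec; []; _∷_)
  open import Data.Vec.Properties using (∷-injective) renaming (≡-dec to Vec-≡-dec)
  open import Function using (_∘_)
  open import Relation.Nullary using (Dec; yes; no; ¬_; contradiction)
  open import Relation.Nullary.Decidable using (_×-dec_)
  open import Relation.Unary using (Pred; Decidable)
  open import Relation.Binary.Definitions using (DecidableEquality)
  open import Relation.Binary.PropositionalEquality using (_≡_; _≢_; refl; sym; trans; cong; cong₂; subst; module ≡-Reasoning)
  open import Algebra.Properties.CommutativeSemigroup +-commutativeSemigroup using (interchange)

  private variable
    A B C : Set
    P Q : Pred A 0ℓ

  indicator : {X : Set} → Dec X → ℕ
  indicator (yes _) = 1
  indicator (no  _) = 0

  count-∷ : (P? : Decidable P) (x : A) (xs : List A) →
            count P? (x ∷ xs) ≡ indicator (P? x) + count P? xs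
  count-∷ P? x xs with P? x
  ... | yes _ = refl
  ... | no  _ = refl

  count-++ : (P? : Decidable P) (xs ys : List A) → count P? (xs ++ ys) ≡ count P? xs + count P? ys
  count-++ P? xs ys = trans (cong length (filter-++ P? xs ys)) (length-++ (filter P? xs))

  count-map : (P? : Decidable P) (f : A → B) (xs : List A) → count P? (map f xs) ≡ count (P? ∘ f) xs
  count-map P? f []       = refl
  count-map P? f (x ∷ xs) with P? (f x)
  ... | yes _ = cong suc (count-map P? f xs)
  ... | no  _ = count-map P? f xs

  count-none : (P? : Decidable P) → (∀ x → ¬ P x) → (xs : List A) → count P? xs ≡ 0
  count-none P? ¬P xs = cong length (filter-none P? (All.universal ¬P xs))

  count-cartesianProduct : {R : Pred (A × B) 0ℓ} (R? : Decidable R) (xs : List A) (ys : List B) →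
    count R? (cartesianProduct xs ys) ≡ sum (map (λ x → count (R? ∘ (x ,_)) ys) xs)
  count-cartesianProduct R? []       ys = refl
  count-cartesianProduct R? (x ∷ xs) ys = trans (count-++ R? (map (x ,_) ys) _)
    (cong₂ _+_ (count-map R? (x ,_) ys) (count-cartesianProduct R? xs ys))

  ∈-─ : {x y : A} {ys : List A} (x∈ys : x ∈ ys) → y ∈ ys → y ≢ x → y ∈ (ys ─ x∈ys)
  ∈-─ (here refl) (here refl) y≢x = contradiction refl y≢x
  ∈-─ (here _)    (there y∈) _    = y∈
  ∈-─ (there _)   (here refl) _   = here refl
  ∈-─ (there x∈)  (there y∈) y≢x  = there (∈-─ x∈ y∈ y≢x)

  unique⊆⇒length≤ : {xs ys : List A} → Unique xs → (∀ {x} → x ∈ xs → x ∈ ys) → length xs ≤ length ys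
  unique⊆⇒length≤ {xs = []}     _            _    = z≤n
  unique⊆⇒length≤ {xs = x ∷ xs} {ys} (x∉ ∷ u) xs⊆ys = subst (suc (length xs) ≤_) (sym (length-removeAt′ ys _))
    (s≤s (unique⊆⇒length≤ u λ y∈xs → ∈-─ x∈ys (xs⊆ys (there y∈xs)) (λ y≡x → All.lookup x∉ y∈xs (sym y≡x))))
    where x∈ys = xs⊆ys (here refl)

  unique-map⁺ : (f : A → B) {xs : List A} → Unique xs → All P xs →
    (∀ {x x'} → P x → P x' → f x ≡ f x' → x ≡ x') → Unique (map f xs)
  unique-map⁺ f []         _          _   = []
  unique-map⁺ {P = P} f {x ∷ _} (x∉ ∷ u) (px ∷ pxs) inj = distinct x∉ pxs ∷ unique-map⁺ f u pxs inj
    where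
    distinct : ∀ {ys} → All (x ≢_) ys → All P ys → All (f x ≢_) (map f ys)
    distinct []           []           = []
    distinct (x≢y ∷ x≢ys) (py ∷ pys) = (λ e → x≢y (inj px py e)) ∷ distinct x≢ys pys

  record Enumeration (A : Set) : Set where
    field
      elements        : List A
      ∈-elements      : ∀ x → x ∈ elements
      elements-unique : Unique elements
      decEq           : DecidableEquality A
  open Enumeration

  count-injection-≤ : (P? : Decidable P) (Q? : Decidable Q) {xs : List A} → Unique xs → (ys : List B) → (∀ y → y ∈ ys) →
    (f : A → B) → (∀ {x} → P x → Q (f x)) → (∀ {x x'} → P x → P x' → f x ≡ f x' → x ≡ x') →
    count P? xs ≤ count Q? ys
  count-injection-≤ P? Q? {xs} xs! ys ∈ys f P⇒Qf inj =
    subst (_≤ count Q? ys) (length-map f (filter P? xs))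
      (unique⊆⇒length≤ (unique-map⁺ f (filter⁺ P? xs!) (all-filter P? xs) inj) image⊆)
    where
    image⊆ : ∀ {y} → y ∈ map f (filter P? xs) → y ∈ filter Q? ys
    image⊆ y∈ with x , x∈ , refl ← ∈-map⁻ f y∈ =
      let px = proj₂ (∈-filter⁻ P? {xs = xs} x∈) in ∈-filter⁺ Q? (∈ys (f x)) (P⇒Qf px)

  count-bijection : (P? : Decidable P) (Q? : Decidable Q) (EA : Enumeration A) (EB : Enumeration B)
    (f : A → B) (g : B → A) → (∀ {x} → P x → Q (f x)) → (∀ {y} → Q y → P (g y)) →
    (∀ {x} → P x → g (f x) ≡ x) → (∀ {y} → Q y → f (g y) ≡ y) →
    count P? (elements EA) ≡ count Q? (elements EB)
  count-bijection P? Q? EA EB f g P⇒Qf Q⇒Pg gf fg = ≤-antisym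
    (count-injection-≤ P? Q? (elements-unique EA) (elements EB) (∈-elements EB) f P⇒Qf
      (λ px px' e → trans (sym (gf px)) (trans (cong g e) (gf px'))))
    (count-injection-≤ Q? P? (elements-unique EB) (elements EA) (∈-elements EA) g Q⇒Pg
      (λ qy qy' e → trans (sym (fg qy)) (trans (cong f e) (fg qy'))))

  sum-indicator : (P? : Decidable P) (xs : List A) → sum (map (indicator ∘ P?) xs) ≡ count P? xs
  sum-indicator P? []       = refl
  sum-indicator P? (x ∷ xs) with P? x
  ... | yes _ = cong suc (sum-indicator P? xs)
  ... | no  _ = sum-indicator P? xs

  count-≟-unique : (_≟_ : DecidableEquality A) {c : A} {xs : List A} → Unique xs → c ∈ xs → count (c ≟_) xs ≡ 1
  count-≟-unique _≟_ {c} (c∉ ∷ _) (here refl) with c ≟ c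
  ... | yes _   = cong length (cong (c ∷_) (filter-none (c ≟_) c∉))
  ... | no c≢c  = contradiction refl c≢c
  count-≟-unique _≟_ {c} {y ∷ _} (y∉ ∷ u) (there c∈) with c ≟ y
  ... | yes refl = contradiction refl (All.lookup y∉ c∈)
  ... | no  _    = count-≟-unique _≟_ u c∈

  sum-map-+ : (g h : B → ℕ) (ys : List B) → sum (map (λ y → g y + h y) ys) ≡ sum (map g ys) + sum (map h ys)
  sum-map-+ g h []       = refl
  sum-map-+ g h (y ∷ ys) = trans (cong (g y + h y +_) (sum-map-+ g h ys)) (interchange (g y) (h y) _ _)

  sum-map-0 : (g : B → ℕ) → (∀ y → g y ≡ 0) → (ys : List B) → sum (map g ys) ≡ 0
  sum-map-0 g g≡0 []       = refl
  sum-map-0 g g≡0 (y ∷ ys) = cong₂ _+_ (g≡0 y) (sum-map-0 g g≡0 ys)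

  sum-map≡count* : (Q? : Decidable Q) (g : B → ℕ) (k : ℕ) →
    (∀ {y} → Q y → g y ≡ k) → (∀ {y} → ¬ Q y → g y ≡ 0) → (ys : List B) → sum (map g ys) ≡ count Q? ys * k
  sum-map≡count* Q? g k on off []       = refl
  sum-map≡count* Q? g k on off (y ∷ ys) with Q? y
  ... | yes q  = cong₂ _+_ (on q) (sum-map≡count* Q? g k on off ys)
  ... | no  ¬q = cong₂ _+_ (off ¬q) (sum-map≡count* Q? g k on off ys)

  fibre? : (P? : Decidable P) (_≟_ : DecidableEquality B) (f : A → B) (y : B) → Decidable (λ x → P x × f x ≡ y)
  fibre? P? _≟_ f y x = P? x ×-dec (f x ≟ y)

  count≡sum-fibres : (P? : Decidable P) (EB : Enumeration B) (f : A → B) (xs : List A) →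
    count P? xs ≡ sum (map (λ y → count (fibre? P? (decEq EB) f y) xs) (elements EB))
  count≡sum-fibres P? EB f []       = sym (sum-map-0 _ (λ _ → refl) (elements EB))
  count≡sum-fibres {P = P} P? EB f (x ∷ xs) = begin
    count P? (x ∷ xs)                                              ≡⟨ count-∷ P? x xs ⟩
    indicator (P? x) + count P? xs                                 ≡⟨ cong₂ _+_ (indicator-fibres (P? x)) (count≡sum-fibres P? EB f xs) ⟩
    sum (map (λ y → indicator (fibre? P? _≟_ f y x)) ys) + sum (map (λ y → count (fibre? P? _≟_ f y) xs) ys)
                                                                   ≡⟨ sym (sum-map-+ _ _ ys) ⟩
    sum (map (λ y → indicator (fibre? P? _≟_ f y x) + count (fibre? P? _≟_ f y) xs) ys)
                                                                   ≡⟨ cong sum (map-cong (λ y → sym (count-∷ (fibre? P? _≟_ f y) x xs)) ys) ⟩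
    sum (map (λ y → count (fibre? P? _≟_ f y) (x ∷ xs)) ys)        ∎
    where
    open ≡-Reasoning
    ys = elements EB
    _≟_ = decEq EB
    indicator-yes-× : {X Y : Set} (x : X) (y? : Dec Y) → indicator (yes x ×-dec y?) ≡ indicator y?
    indicator-yes-× x (yes _) = refl
    indicator-yes-× x (no  _) = refl
    indicator-fibres : (px? : Dec (P x)) → indicator px? ≡ sum (map (λ y → indicator (px? ×-dec (f x ≟ y))) ys)
    indicator-fibres (yes px) = sym (begin
      sum (map (λ y → indicator (yes px ×-dec (f x ≟ y))) ys) ≡⟨ cong sum (map-cong (λ y → indicator-yes-× px (f x ≟ y)) ys) ⟩
      sum (map (λ y → indicator (f x ≟ y)) ys)                ≡⟨ sum-indicator (f x ≟_) ys ⟩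
      count (f x ≟_) ys                                       ≡⟨ count-≟-unique _≟_ (elements-unique EB) (∈-elements EB (f x)) ⟩
      1                                                       ∎)
    indicator-fibres (no ¬px) = sym (sum-map-0 _ (λ _ → refl) ys)

  count-by-fibres : (P? : Decidable P) (Q? : Decidable Q) (EB : Enumeration B) (f : A → B) (xs : List A) (k : ℕ) →
    (∀ {x} → P x → Q (f x)) → (∀ {y} → Q y → count (fibre? P? (decEq EB) f y) xs ≡ k) →
    count P? xs ≡ count Q? (elements EB) * k
  count-by-fibres {Q = Q} P? Q? EB f xs k P⇒Qf fibre-size =
    trans (count≡sum-fibres P? EB f xs) (sum-map≡count* Q? _ k fibre-size empty-fibre (elements EB))
    where
    empty-fibre : ∀ {y} → ¬ Q y → count (fibre? P? (decEq EB) f y) xs ≡ 0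
    empty-fibre ¬Qy = count-none _ (λ { x (px , refl) → ¬Qy (P⇒Qf px) }) xs

  concatMap-map≡cartesianProductWith : (g : A → B → C) (xs : List A) (ys : List B) →
    concatMap (λ x → map (g x) ys) xs ≡ cartesianProductWith g xs ys
  concatMap-map≡cartesianProductWith g []       ys = refl
  concatMap-map≡cartesianProductWith g (x ∷ xs) ys = cong (map (g x) ys ++_) (concatMap-map≡cartesianProductWith g xs ys)

  length-cartesianProductWith : (g : A → B → C) (xs : List A) (ys : List B) →
    length (cartesianProductWith g xs ys) ≡ length xs * length ys
  length-cartesianProductWith g []       ys = refl
  length-cartesianProductWith g (x ∷ xs) ys = trans (length-++ (map (g x) ys))
    (cong₂ _+_ (length-map (g x) ys) (length-cartesianProductWith g xs ys))

  allVecs-suc : (xs : List A) (n : ℕ) → allVecs xs (suc n) ≡ cartesianProductWith _∷_ xs (allVecs xs n)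
  allVecs-suc xs n = concatMap-map≡cartesianProductWith _∷_ xs (allVecs xs n)

  ∈-allVecs : {xs : List A} → (∀ x → x ∈ xs) → ∀ n (v : Vec A n) → v ∈ allVecs xs n
  ∈-allVecs ∈xs zero    []      = here refl
  ∈-allVecs {xs = xs} ∈xs (suc n) (a ∷ v) =
    subst (a ∷ v ∈_) (sym (allVecs-suc xs n)) (∈-cartesianProductWith⁺ _∷_ (∈xs a) (∈-allVecs ∈xs n v))

  allVecs-unique : {xs : List A} → Unique xs → ∀ n → Unique (allVecs xs n)
  allVecs-unique xs! zero    = [] ∷ []
  allVecs-unique {xs = xs} xs! (suc n) =
    subst Unique (sym (allVecs-suc xs n)) (cartesianProductWith⁺ _∷_ ∷-injective xs! (allVecs-unique xs! n))

  length-allVecs : (xs : List A) (n : ℕ) → length (allVecs xs n) ≡ length xs ^ n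
  length-allVecs xs zero    = refl
  length-allVecs xs (suc n) = trans (cong length (allVecs-suc xs n))
    (trans (length-cartesianProductWith _∷_ xs (allVecs xs n)) (cong (length xs *_) (length-allVecs xs n)))

  vec-enumeration : Enumeration A → ∀ n → Enumeration (Vec A n)
  vec-enumeration E n = record
    { elements        = allVecs (elements E) n
    ; ∈-elements      = ∈-allVecs (∈-elements E) n
    ; elements-unique = allVecs-unique (elements-unique E) n
    ; decEq           = Vec-≡-dec (decEq E)
    }

  ×-enumeration : Enumeration A → Enumeration B → Enumeration (A × B)
  ×-enumeration EA EB = record
    { elements        = cartesianProduct (elements EA) (elements EB)
    ; ∈-elements      = λ (a , b) → ∈-cartesianProduct⁺ (∈-elements EA a) (∈-elements EB b)
    ; elements-unique = cartesianProduct⁺ (elements-unique EA) (elements-unique EB)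
    ; decEq           = ≡-dec (decEq EA) (decEq EB)
    }

  bool-enumeration : Enumeration Bool
  bool-enumeration = record
    { elements        = true ∷ false ∷ []
    ; ∈-elements      = λ { true → here refl ; false → there (here refl) }
    ; elements-unique = ((λ ()) ∷ []) ∷ [] ∷ []
    ; decEq           = Bool._≟_
    }

  sum-count-filter : (P? : Decidable P) {R : A → Pred B 0ℓ} (R? : ∀ x → Decidable (R x)) (xs : List A) (ys : List B) →
    sum (map (λ x → count (R? x) ys) (filter P? xs)) ≡ count (λ p → P? (proj₁ p) ×-dec R? (proj₁ p) (proj₂ p)) (cartesianProduct xs ys)
  sum-count-filter P? R? xs ys = trans (go xs) (sym (count-cartesianProduct _ xs ys))
    where
    go : ∀ xs → sum (map (λ x → count (R? x) ys) (filter P? xs)) ≡ sum (map (λ x → count (λ y → P? x ×-dec R? x y) ys) xs)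
    go []       = refl
    go (x ∷ xs) with P? x
    ... | yes px  = cong₂ _+_ (cong length (filter-≐ (R? x) _ ((px ,_) , proj₂) ys)) (go xs)
    ... | no  ¬px = trans (go xs) (cong (_+ _) (sym (count-none _ (λ _ → ¬px ∘ proj₁) ys)))

module Matrices (F : FiniteField) where

  open import Level using (0ℓ)
  open import Data.Nat using (zero; suc)
  open import Data.Vec as V using ([]; _∷_)
  open import Data.Vec.Properties using (tabulate-cong; tabulate-∘; zipWith-is-⊛; map-replicate)
  open import Data.Product using (∃; _×_; _,_; proj₁; proj₂)
  open import Function using (_∘_)
  open import Relation.Nullary using (Dec; yes; no; contradiction)
  open import Relation.Nullary.Decidable using (_→-dec_)
  open import Relation.Binary.PropositionalEquality using (_≡_; refl; sym; trans; cong; cong₂; module ≡-Reasoning)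
  open import Algebra.Bundles using (CommutativeRing)

  open LinAlg F
  open ≡-Reasoning

  ring : CommutativeRing 0ℓ 0ℓ
  ring = record { isCommutativeRing = isCommutativeRing }

  open CommutativeRing ring using (+-identityˡ; +-identityʳ; -‿inverseʳ; *-assoc; *-comm; *-identityˡ; *-identityʳ;
    distribˡ; zeroˡ; zeroʳ; +-commutativeSemigroup)
  open import Algebra.Properties.Ring (CommutativeRing.ring ring)
    using (-1*x≈-x; x∙y⁻¹≈ε⇒x≈y; +-inverseʳ-unique; -‿distribˡ-*; -‿distribʳ-*; -‿involutive)
  open import Algebra.Properties.CommutativeSemigroup +-commutativeSemigroup using (interchange)

  private variable
    k l m n : ℕ

  infixl 6 _+ᵥ_ _-ᵥ_
  infixr 7 _•_

  _+ᵥ_ : Vect n → Vect n → Vect n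
  _+ᵥ_ = V.zipWith _+_

  _•_ : Carrier → Vect n → Vect n
  c • v = V.map (c *_) v

  _-ᵥ_ : Vect n → Vect n → Vect n
  u -ᵥ v = u +ᵥ (- 1#) • v

  dot-zeroʳ : (u : Vect n) → dot u (zeroV n) ≡ 0#
  dot-zeroʳ []      = refl
  dot-zeroʳ (a ∷ u) = trans (cong₂ _+_ (zeroʳ a) (dot-zeroʳ u)) (+-identityˡ 0#)

  dot-zeroˡ : (u : Vect n) → dot (zeroV n) u ≡ 0#
  dot-zeroˡ []      = refl
  dot-zeroˡ (a ∷ u) = trans (cong₂ _+_ (zeroˡ a) (dot-zeroˡ u)) (+-identityˡ 0#)

  dot-comm : (u v : Vect n) → dot u v ≡ dot v u
  dot-comm []      []      = refl
  dot-comm (a ∷ u) (b ∷ v) = cong₂ _+_ (*-comm a b) (dot-comm u v)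

  dot-+ᵥʳ : (u v w : Vect n) → dot u (v +ᵥ w) ≡ dot u v + dot u w
  dot-+ᵥʳ []      []      []      = sym (+-identityˡ 0#)
  dot-+ᵥʳ (a ∷ u) (b ∷ v) (c ∷ w) = trans (cong₂ _+_ (distribˡ a b c) (dot-+ᵥʳ u v w)) (interchange _ _ _ _)

  dot-+ᵥˡ : (u v w : Vect n) → dot (v +ᵥ w) u ≡ dot v u + dot w u
  dot-+ᵥˡ u v w = trans (dot-comm (v +ᵥ w) u) (trans (dot-+ᵥʳ u v w) (cong₂ _+_ (dot-comm u v) (dot-comm u w)))

  dot-•ʳ : (c : Carrier) (u v : Vect n) → dot u (c • v) ≡ c * dot u v
  dot-•ʳ c []      []      = sym (zeroʳ c)
  dot-•ʳ c (a ∷ u) (b ∷ v) = begin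
    a * (c * b) + dot u (c • v) ≡⟨ cong₂ _+_ (sym (*-assoc a c b)) (dot-•ʳ c u v) ⟩
    (a * c) * b + c * dot u v   ≡⟨ cong (λ z → z * b + c * dot u v) (*-comm a c) ⟩
    (c * a) * b + c * dot u v   ≡⟨ cong (_+ c * dot u v) (*-assoc c a b) ⟩
    c * (a * b) + c * dot u v   ≡⟨ sym (distribˡ c (a * b) (dot u v)) ⟩
    c * (a * b + dot u v)       ∎

  dot-•ˡ : (c : Carrier) (u v : Vect n) → dot (c • v) u ≡ c * dot v u
  dot-•ˡ c u v = trans (dot-comm (c • v) u) (trans (dot-•ʳ c u v) (cong (c *_) (dot-comm u v)))

  ·-+ᵥ : (M : Mat m n) (u v : Vect n) → M · (u +ᵥ v) ≡ M · u +ᵥ M · v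
  ·-+ᵥ []      u v = refl
  ·-+ᵥ (r ∷ M) u v = cong₂ _∷_ (dot-+ᵥʳ r u v) (·-+ᵥ M u v)

  ·-• : (M : Mat m n) (c : Carrier) (v : Vect n) → M · (c • v) ≡ c • (M · v)
  ·-• []      c v = refl
  ·-• (r ∷ M) c v = cong₂ _∷_ (dot-•ʳ c r v) (·-• M c v)

  ·-zeroV : (M : Mat m n) → M · zeroV n ≡ zeroV m
  ·-zeroV []      = refl
  ·-zeroV (r ∷ M) = cong₂ _∷_ (dot-zeroʳ r) (·-zeroV M)

  ·-−ᵥ : (M : Mat m n) (u v : Vect n) → M · (u -ᵥ v) ≡ M · u -ᵥ M · v
  ·-−ᵥ M u v = trans (·-+ᵥ M u _) (cong (M · u +ᵥ_) (·-• M (- 1#) v))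

  dot-transpose : (r : Vect k) (B : Mat k n) (v : Vect n) → dot (V.map (dot r) (V.transpose B)) v ≡ dot r (B · v)
  dot-transpose {n = n} [] [] v = trans (cong (λ z → dot z v) (map-replicate (dot []) [] n)) (dot-zeroˡ v)
  dot-transpose (a ∷ r) (b ∷ B) v = begin
    dot (V.map (dot (a ∷ r)) (V.transpose (b ∷ B))) v
      ≡⟨ cong (λ z → dot (V.map (dot (a ∷ r)) z) v) (sym (zipWith-is-⊛ _∷_ b (V.transpose B))) ⟩
    dot (V.map (dot (a ∷ r)) (V.zipWith _∷_ b (V.transpose B))) v
      ≡⟨ cong (λ z → dot z v) (dot-cons-column b (V.transpose B)) ⟩
    dot ((a • b) +ᵥ V.map (dot r) (V.transpose B)) v
      ≡⟨ dot-+ᵥˡ v (a • b) _ ⟩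
    dot (a • b) v + dot (V.map (dot r) (V.transpose B)) v
      ≡⟨ cong₂ _+_ (dot-•ˡ a v b) (dot-transpose r B v) ⟩
    a * dot b v + dot r (B · v) ∎
    where
    dot-cons-column : (b : Vect m) (T : Mat m _) → V.map (dot (a ∷ r)) (V.zipWith _∷_ b T) ≡ (a • b) +ᵥ V.map (dot r) T
    dot-cons-column []      []      = refl
    dot-cons-column (x ∷ b) (t ∷ T) = cong (_ ∷_) (dot-cons-column b T)

  ⊗-· : (A : Mat m k) (B : Mat k n) (v : Vect n) → (A ⊗ B) · v ≡ A · (B · v)
  ⊗-· []      B v = refl
  ⊗-· (r ∷ A) B v = cong₂ _∷_ (dot-transpose r B v) (⊗-· A B v)

  row-ext : (r s : Vect n) → (∀ v → dot r v ≡ dot s v) → r ≡ s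
  row-ext []      []      _ = refl
  row-ext {suc n} (a ∷ r) (b ∷ s) r≗s = cong₂ _∷_ head-≡ (row-ext r s tail-≗)
    where
    dot-e₀ : ∀ x (t : Vect n) → dot (x ∷ t) (1# ∷ zeroV n) ≡ x
    dot-e₀ x t = trans (cong₂ _+_ (*-identityʳ x) (dot-zeroʳ t)) (+-identityʳ x)
    dot-0∷ : ∀ x (t w : Vect n) → dot (x ∷ t) (0# ∷ w) ≡ dot t w
    dot-0∷ x t w = trans (cong (_+ dot t w) (zeroʳ x)) (+-identityˡ _)
    head-≡ : a ≡ b
    head-≡ = trans (sym (dot-e₀ a r)) (trans (r≗s (1# ∷ zeroV n)) (dot-e₀ b s))
    tail-≗ : ∀ w → dot r w ≡ dot s w
    tail-≗ w = trans (sym (dot-0∷ a r w)) (trans (r≗s (0# ∷ w)) (dot-0∷ b s w))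

  matrix-ext : (M N : Mat m n) → (∀ v → M · v ≡ N · v) → M ≡ N
  matrix-ext []      []      _   = refl
  matrix-ext (r ∷ M) (s ∷ N) M≗N = cong₂ _∷_ (row-ext r s (cong V.head ∘ M≗N)) (matrix-ext M N (cong V.tail ∘ M≗N))

  idMat-suc : ∀ n → idMat (suc n) ≡ (1# ∷ zeroV n) ∷ V.map (0# ∷_) (idMat n)
  idMat-suc n = cong₂ _∷_ (cong (1# ∷_) (tabulate-const n)) (trans (tabulate-cong (λ _ → refl)) (tabulate-∘ (0# ∷_) _))
    where
    tabulate-const : ∀ n → V.tabulate {n = n} (λ _ → 0#) ≡ zeroV n
    tabulate-const zero    = refl
    tabulate-const (suc n) = cong (0# ∷_) (tabulate-const n)

  idMat-· : (v : Vect n) → idMat n · v ≡ v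
  idMat-· []              = refl
  idMat-· {suc n} (a ∷ w) = trans (cong (_· (a ∷ w)) (idMat-suc n))
    (cong₂ _∷_ (trans (cong₂ _+_ (*-identityˡ a) (dot-zeroˡ w)) (+-identityʳ a)) (trans (0∷-· (idMat n)) (idMat-· w)))
    where
    0∷-· : (M : Mat m n) → V.map (0# ∷_) M · (a ∷ w) ≡ M · w
    0∷-· []      = refl
    0∷-· (r ∷ M) = cong₂ _∷_ (trans (cong (_+ dot r w) (zeroˡ a)) (+-identityˡ _)) (0∷-· M)

  ⊗-assoc : (A : Mat m k) (B : Mat k l) (C : Mat l n) → (A ⊗ B) ⊗ C ≡ A ⊗ (B ⊗ C)
  ⊗-assoc A B C = matrix-ext _ _ λ v → begin
    ((A ⊗ B) ⊗ C) · v ≡⟨ ⊗-· (A ⊗ B) C v ⟩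
    (A ⊗ B) · (C · v) ≡⟨ ⊗-· A B (C · v) ⟩
    A · (B · (C · v)) ≡⟨ cong (A ·_) (sym (⊗-· B C v)) ⟩
    A · ((B ⊗ C) · v) ≡⟨ sym (⊗-· A (B ⊗ C) v) ⟩
    (A ⊗ (B ⊗ C)) · v ∎

  ⊗-identityʳ : (A : Mat m n) → A ⊗ idMat n ≡ A
  ⊗-identityʳ A = matrix-ext _ _ λ v → trans (⊗-· A (idMat _) v) (cong (A ·_) (idMat-· v))

  ⊗-identityˡ : (A : Mat m n) → idMat m ⊗ A ≡ A
  ⊗-identityˡ A = matrix-ext _ _ λ v → trans (⊗-· (idMat _) A v) (idMat-· (A · v))

  ⊗-cancel-middle : (A : Mat m n) (X : Mat n k) (Y : Mat k n) (B : Mat n l) → X ⊗ Y ≡ idMat n → (A ⊗ X) ⊗ (Y ⊗ B) ≡ A ⊗ B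
  ⊗-cancel-middle A X Y B XY≡1 = begin
    (A ⊗ X) ⊗ (Y ⊗ B) ≡⟨ ⊗-assoc A X (Y ⊗ B) ⟩
    A ⊗ (X ⊗ (Y ⊗ B)) ≡⟨ cong (A ⊗_) (sym (⊗-assoc X Y B)) ⟩
    A ⊗ ((X ⊗ Y) ⊗ B) ≡⟨ cong (λ Z → A ⊗ (Z ⊗ B)) XY≡1 ⟩
    A ⊗ (idMat _ ⊗ B) ≡⟨ cong (A ⊗_) (⊗-identityˡ B) ⟩
    A ⊗ B             ∎

  ⊗-cancelʳ-inverse : (A : Mat m n) (X Y : Mat n n) → X ⊗ Y ≡ idMat n → (A ⊗ X) ⊗ Y ≡ A
  ⊗-cancelʳ-inverse A X Y XY≡1 = trans (⊗-assoc A X Y) (trans (cong (A ⊗_) XY≡1) (⊗-identityʳ A))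

  ⊗-cancelˡ-inverse : (X Y : Mat m m) (A : Mat m n) → X ⊗ Y ≡ idMat m → X ⊗ (Y ⊗ A) ≡ A
  ⊗-cancelˡ-inverse X Y A XY≡1 = trans (sym (⊗-assoc X Y A)) (trans (cong (_⊗ A) XY≡1) (⊗-identityˡ A))

  ⊗≡⇒·≡ : {A : Mat m k} {B : Mat k n} {C : Mat m n} → A ⊗ B ≡ C → ∀ v → A · (B · v) ≡ C · v
  ⊗≡⇒·≡ {A = A} {B} AB≡C v = trans (sym (⊗-· A B v)) (cong (_· v) AB≡C)

  ·-inverse : (X Y : Mat m m) → X ⊗ Y ≡ idMat m → ∀ v → X · (Y · v) ≡ v
  ·-inverse X Y XY≡1 v = trans (⊗≡⇒·≡ XY≡1 v) (idMat-· v)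

  -ᵥ-self : (v : Vect n) → v -ᵥ v ≡ zeroV n
  -ᵥ-self []      = refl
  -ᵥ-self (a ∷ v) = cong₂ _∷_ (trans (cong (a +_) (-1*x≈-x a)) (-‿inverseʳ a)) (-ᵥ-self v)

  -ᵥ≡0⇒≡ : (u v : Vect n) → u -ᵥ v ≡ zeroV n → u ≡ v
  -ᵥ≡0⇒≡ []      []      _  = refl
  -ᵥ≡0⇒≡ (a ∷ u) (b ∷ v) eq = cong₂ _∷_
    (x∙y⁻¹≈ε⇒x≈y a b (trans (cong (a +_) (sym (-1*x≈-x b))) (cong V.head eq)))
    (-ᵥ≡0⇒≡ u v (cong V.tail eq))

  Injective : Mat n k → Set
  Injective {n} {k} ι = ∀ (x : Vect k) → ι · x ≡ zeroV n → x ≡ zeroV k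

  Injective⇒·-injective : {ι : Mat n k} → Injective ι → ∀ {x y} → ι · x ≡ ι · y → x ≡ y
  Injective⇒·-injective {ι = ι} ι! {x} {y} ιx≡ιy = -ᵥ≡0⇒≡ x y
    (ι! (x -ᵥ y) (trans (·-−ᵥ ι x y) (trans (cong (_-ᵥ ι · y) ιx≡ιy) (-ᵥ-self (ι · y)))))

  Injective-⊗ : (A : Mat n m) (B : Mat m k) → Injective A → Injective B → Injective (A ⊗ B)
  Injective-⊗ A B A! B! x ABx≡0 = B! x (A! (B · x) (trans (sym (⊗-· A B x)) ABx≡0))

  Injective⇒⊗-cancelˡ : (ι : Mat n m) → Injective ι → (X Y : Mat m k) → ι ⊗ X ≡ ι ⊗ Y → X ≡ Y
  Injective⇒⊗-cancelˡ ι ι! X Y ιX≡ιY = matrix-ext X Y λ v →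
    Injective⇒·-injective ι! (trans (sym (⊗-· ι X v)) (trans (cong (_· v) ιX≡ιY) (⊗-· ι Y v)))

  Invertible-inverse : (A : Mat n n) (A-inv : Invertible A) → Invertible (proj₁ A-inv)
  Invertible-inverse A (_ , AA⁻¹ , A⁻¹A) = A , A⁻¹A , AA⁻¹

  Invertible⇒Injective : (g : Mat n n) → Invertible g → Injective g
  Invertible⇒Injective {n} g (h , _ , hg≡1) x gx≡0 = begin
    x           ≡⟨ sym (·-inverse h g hg≡1 x) ⟩
    h · (g · x) ≡⟨ cong (h ·_) gx≡0 ⟩
    h · zeroV n ≡⟨ ·-zeroV h ⟩
    zeroV n     ∎

  Invertible-⊗ : (A B : Mat n n) → Invertible A → Invertible B → Invertible (A ⊗ B)
  Invertible-⊗ A B (A⁻¹ , AA⁻¹ , A⁻¹A) (B⁻¹ , BB⁻¹ , B⁻¹B) =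
    B⁻¹ ⊗ A⁻¹ , trans (⊗-cancel-middle A B B⁻¹ A⁻¹ BB⁻¹) AA⁻¹ , trans (⊗-cancel-middle B⁻¹ A⁻¹ A B A⁻¹A) B⁻¹B

  IsLinearForm : (Vect n → Carrier) → Set
  IsLinearForm ℓ = (∀ u v → ℓ (u +ᵥ v) ≡ ℓ u + ℓ v) × (∀ c v → ℓ (c • v) ≡ c * ℓ v)

  IsLinear : (Vect n → Vect m) → Set
  IsLinear φ = (∀ u v → φ (u +ᵥ v) ≡ φ u +ᵥ φ v) × (∀ c v → φ (c • v) ≡ c • φ v)

  ·-isLinear : (M : Mat m n) → IsLinear (M ·_)
  ·-isLinear M = ·-+ᵥ M , ·-• M

  rowOf : (Vect n → Carrier) → Vect n
  rowOf {zero}  ℓ = []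
  rowOf {suc n} ℓ = ℓ (1# ∷ zeroV n) ∷ rowOf (λ w → ℓ (0# ∷ w))

  dot-rowOf : (ℓ : Vect n → Carrier) → IsLinearForm ℓ → ∀ v → dot (rowOf ℓ) v ≡ ℓ v
  dot-rowOf ℓ (_ , ℓ-•) [] = trans (sym (zeroˡ (ℓ []))) (sym (ℓ-• 0# []))
  dot-rowOf {suc n} ℓ (ℓ-+ , ℓ-•) (a ∷ w) = begin
    ℓ (1# ∷ zeroV n) * a + dot (rowOf ℓ₀) w  ≡⟨ cong₂ _+_ (*-comm _ a) (dot-rowOf ℓ₀ ℓ₀-linear w) ⟩
    a * ℓ (1# ∷ zeroV n) + ℓ (0# ∷ w)       ≡⟨ cong (_+ ℓ (0# ∷ w)) (sym (ℓ-• a _)) ⟩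
    ℓ (a • (1# ∷ zeroV n)) + ℓ (0# ∷ w)     ≡⟨ sym (ℓ-+ _ _) ⟩
    ℓ (a • (1# ∷ zeroV n) +ᵥ (0# ∷ w))      ≡⟨ cong ℓ (cong₂ _∷_ (trans (cong (_+ 0#) (*-identityʳ a)) (+-identityʳ a)) (•zero+ᵥ w)) ⟩
    ℓ (a ∷ w)                               ∎
    where
    ℓ₀ : Vect n → Carrier
    ℓ₀ w = ℓ (0# ∷ w)
    ℓ₀-linear : IsLinearForm ℓ₀
    ℓ₀-linear = (λ u v → trans (cong (λ c → ℓ (c ∷ (u +ᵥ v))) (sym (+-identityˡ 0#))) (ℓ-+ (0# ∷ u) (0# ∷ v)))
              , (λ c v → trans (cong (λ z → ℓ (z ∷ (c • v))) (sym (zeroʳ c))) (ℓ-• c (0# ∷ v)))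
    •zero+ᵥ : ∀ {k} (w : Vect k) → a • zeroV k +ᵥ w ≡ w
    •zero+ᵥ []      = refl
    •zero+ᵥ (x ∷ w) = cong₂ _∷_ (trans (cong (_+ x) (zeroʳ a)) (+-identityˡ x)) (•zero+ᵥ w)

  matrixOf : (Vect n → Vect m) → Mat m n
  matrixOf {m = zero}  φ = []
  matrixOf {m = suc m} φ = rowOf (V.head ∘ φ) ∷ matrixOf (V.tail ∘ φ)

  matrixOf-· : (φ : Vect n → Vect m) → IsLinear φ → ∀ v → matrixOf φ · v ≡ φ v
  matrixOf-· {m = zero}  φ _ v with φ v
  ... | [] = refl
  matrixOf-· {m = suc m} φ (φ-+ , φ-•) v = trans
    (cong₂ _∷_ (dot-rowOf (V.head ∘ φ) head-linear v) (matrixOf-· (V.tail ∘ φ) tail-linear v)) (head∷tail (φ v))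
    where
    head∷tail : (x : Vect (suc m)) → V.head x ∷ V.tail x ≡ x
    head∷tail (_ ∷ _) = refl
    head-linear : IsLinearForm (V.head ∘ φ)
    head-linear = (λ u w → trans (cong V.head (φ-+ u w)) (head-+ᵥ (φ u) (φ w)))
                , (λ c w → trans (cong V.head (φ-• c w)) (head-• c (φ w)))
      where
      head-+ᵥ : (x y : Vect (suc m)) → V.head (x +ᵥ y) ≡ V.head x + V.head y
      head-+ᵥ (_ ∷ _) (_ ∷ _) = refl
      head-• : ∀ c (x : Vect (suc m)) → V.head (c • x) ≡ c * V.head x
      head-• c (_ ∷ _) = refl
    tail-linear : IsLinear (V.tail ∘ φ)
    tail-linear = (λ u w → trans (cong V.tail (φ-+ u w)) (tail-+ᵥ (φ u) (φ w)))
                , (λ c w → trans (cong V.tail (φ-• c w)) (tail-• c (φ w)))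
      where
      tail-+ᵥ : (x y : Vect (suc m)) → V.tail (x +ᵥ y) ≡ V.tail x +ᵥ V.tail y
      tail-+ᵥ (_ ∷ _) (_ ∷ _) = refl
      tail-• : ∀ c (x : Vect (suc m)) → V.tail (c • x) ≡ c • V.tail x
      tail-• c (_ ∷ _) = refl

  lift-through-injective : (ι : Mat n k) → Injective ι → (ψ : Vect m → Vect n) → IsLinear ψ →
    (∀ y → ∃ λ x → ι · x ≡ ψ y) → ∃ λ (g : Mat k m) → ∀ y → ι · (g · y) ≡ ψ y
  lift-through-injective ι ι! ψ (ψ-+ , ψ-•) preimage =
    matrixOf φ , λ y → trans (cong (ι ·_) (matrixOf-· φ φ-linear y)) (ιφ y)
    where
    φ = proj₁ ∘ preimage
    ιφ = proj₂ ∘ preimage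
    φ-linear : IsLinear φ
    φ-linear = (λ u v → Injective⇒·-injective ι! (begin
                  ι · φ (u +ᵥ v)        ≡⟨ trans (ιφ (u +ᵥ v)) (ψ-+ u v) ⟩
                  ψ u +ᵥ ψ v            ≡⟨ sym (cong₂ _+ᵥ_ (ιφ u) (ιφ v)) ⟩
                  ι · φ u +ᵥ ι · φ v    ≡⟨ sym (·-+ᵥ ι (φ u) (φ v)) ⟩
                  ι · (φ u +ᵥ φ v)      ∎))
             , (λ c v → Injective⇒·-injective ι! (begin
                  ι · φ (c • v)         ≡⟨ trans (ιφ (c • v)) (ψ-• c v) ⟩
                  c • ψ v               ≡⟨ cong (c •_) (sym (ιφ v)) ⟩
                  c • (ι · φ v)         ≡⟨ sym (·-• ι c (φ v)) ⟩
                  ι · (c • φ v)         ∎))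

  0•+ᵥ : (v w : Vect n) → 0# • v +ᵥ w ≡ w
  0•+ᵥ []      []      = refl
  0•+ᵥ (a ∷ v) (b ∷ w) = cong₂ _∷_ (trans (cong (_+ b) (zeroˡ a)) (+-identityˡ b)) (0•+ᵥ v w)

  c•v+w≡0⇒v≡-c⁻¹•w : ∀ {c c⁻¹} → c * c⁻¹ ≡ 1# → (v w : Vect n) → c • v +ᵥ w ≡ zeroV n → v ≡ (- c⁻¹) • w
  c•v+w≡0⇒v≡-c⁻¹•w cc⁻¹ []      []      _  = refl
  c•v+w≡0⇒v≡-c⁻¹•w {c = c} {c⁻¹} cc⁻¹ (a ∷ v) (b ∷ w) eq =
    cong₂ _∷_ (sym scalar) (c•v+w≡0⇒v≡-c⁻¹•w cc⁻¹ v w (cong V.tail eq))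
    where
    scalar : (- c⁻¹) * b ≡ a
    scalar = begin
      (- c⁻¹) * b             ≡⟨ cong ((- c⁻¹) *_) (+-inverseʳ-unique (c * a) b (cong V.head eq)) ⟩
      (- c⁻¹) * (- (c * a))   ≡⟨ sym (-‿distribʳ-* (- c⁻¹) (c * a)) ⟩
      - ((- c⁻¹) * (c * a))   ≡⟨ cong -_ (sym (-‿distribˡ-* c⁻¹ (c * a))) ⟩
      - (- (c⁻¹ * (c * a)))   ≡⟨ -‿involutive _ ⟩
      c⁻¹ * (c * a)           ≡⟨ sym (*-assoc c⁻¹ c a) ⟩
      (c⁻¹ * c) * a           ≡⟨ cong (_* a) (trans (*-comm c⁻¹ c) cc⁻¹) ⟩
      1# * a                  ≡⟨ *-identityˡ a ⟩
      a                       ∎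

  injective? : (ι : Mat n k) → Dec (Injective ι)
  injective? {n} {k} ι = forall? (searchVect k) (λ x → vect? (ι · x) (zeroV n) →-dec vect? x (zeroV k))

  infixl 7 _\\_

  -- ι \\ L solves ι ⊗ g ≡ L for g; when there is no solution its value is a junk zero matrix.
  _\\_ : Mat n k → Mat n m → Mat k m
  _\\_ {k = k} {m} ι L with searchMat k m (λ g → mat? (ι ⊗ g) L)
  ... | yes (g , _) = g
  ... | no  _       = V.replicate k (zeroV m)

  \\-unique : (ι : Mat n k) → Injective ι → (g : Mat k m) {L : Mat n m} → ι ⊗ g ≡ L → ι \\ L ≡ g
  \\-unique {k = k} {m} ι ι! g {L} ιg≡L with searchMat k m (λ g → mat? (ι ⊗ g) L)
  ... | yes (g′ , ιg′≡L) = Injective⇒⊗-cancelˡ ι ι! g′ g (trans ιg′≡L (sym ιg≡L))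
  ... | no  ∄g           = contradiction (g , ιg≡L) ∄g

  ⊗-intertwine : (T : Mat n n) (ι : Mat n k) (A g h : Mat k k) → T ⊗ ι ≡ ι ⊗ A → g ⊗ h ≡ idMat k →
    T ⊗ (ι ⊗ g) ≡ (ι ⊗ g) ⊗ ((h ⊗ A) ⊗ g)
  ⊗-intertwine T ι A g h Tι≡ιA gh≡1 = begin
    T ⊗ (ι ⊗ g)               ≡⟨ sym (⊗-assoc T ι g) ⟩
    (T ⊗ ι) ⊗ g               ≡⟨ cong (_⊗ g) Tι≡ιA ⟩
    (ι ⊗ A) ⊗ g               ≡⟨ ⊗-assoc ι A g ⟩
    ι ⊗ (A ⊗ g)               ≡⟨ sym (⊗-cancel-middle ι g h (A ⊗ g) gh≡1) ⟩
    (ι ⊗ g) ⊗ (h ⊗ (A ⊗ g))   ≡⟨ cong ((ι ⊗ g) ⊗_) (sym (⊗-assoc h A g)) ⟩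
    (ι ⊗ g) ⊗ ((h ⊗ A) ⊗ g)   ∎

  conjugate-cancel : (B u w : Mat k k) → w ⊗ u ≡ idMat k → (w ⊗ ((u ⊗ B) ⊗ w)) ⊗ u ≡ B
  conjugate-cancel B u w wu≡1 = begin
    (w ⊗ ((u ⊗ B) ⊗ w)) ⊗ u   ≡⟨ ⊗-assoc w ((u ⊗ B) ⊗ w) u ⟩
    w ⊗ (((u ⊗ B) ⊗ w) ⊗ u)   ≡⟨ cong (w ⊗_) (⊗-cancelʳ-inverse (u ⊗ B) w u wu≡1) ⟩
    w ⊗ (u ⊗ B)               ≡⟨ ⊗-cancelˡ-inverse w u B wu≡1 ⟩
    B                         ∎

  InClass⇒Invertible : {A₀ A : Mat k k} → Invertible A₀ → InClass A₀ A → Invertible A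
  InClass⇒Invertible {A₀ = A₀} A₀-inv (g , h , gh≡1 , hg≡1 , refl) =
    Invertible-⊗ (g ⊗ A₀) h (Invertible-⊗ g A₀ (h , gh≡1 , hg≡1) A₀-inv) (g , hg≡1 , gh≡1)

  InClass-conjugate : (A₀ A g h : Mat k k) → g ⊗ h ≡ idMat k → h ⊗ g ≡ idMat k →
    InClass A₀ A → InClass A₀ ((h ⊗ A) ⊗ g)
  InClass-conjugate A₀ _ g h gh≡1 hg≡1 (u , w , uw≡1 , wu≡1 , refl) =
    h ⊗ u , w ⊗ g , trans (⊗-cancel-middle h u w g uw≡1) hg≡1 , trans (⊗-cancel-middle w g h u gh≡1) wu≡1 , (begin
      (h ⊗ ((u ⊗ A₀) ⊗ w)) ⊗ g   ≡⟨ ⊗-assoc h ((u ⊗ A₀) ⊗ w) g ⟩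
      h ⊗ (((u ⊗ A₀) ⊗ w) ⊗ g)   ≡⟨ cong (h ⊗_) (⊗-assoc (u ⊗ A₀) w g) ⟩
      h ⊗ ((u ⊗ A₀) ⊗ (w ⊗ g))   ≡⟨ sym (⊗-assoc h (u ⊗ A₀) (w ⊗ g)) ⟩
      (h ⊗ (u ⊗ A₀)) ⊗ (w ⊗ g)   ≡⟨ cong (_⊗ (w ⊗ g)) (sym (⊗-assoc h u A₀)) ⟩
      ((h ⊗ u) ⊗ A₀) ⊗ (w ⊗ g)   ∎)

module InjectiveMatrices (F : FiniteField) where

  open import Data.Nat as ℕ using (zero; suc; _<_; _∸_; s≤s)
  open import Data.Nat.Properties using (^-monoʳ-<; <-irrefl; <-≤-trans; +-suc; m≤n+m; m∸n+n≡m)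
  open import Data.List using (List; length; map)
  open import Data.List.Properties using (length-map)
  open import Data.List.Membership.Propositional using (_∈_)
  open import Data.List.Relation.Unary.Any using (any?)
  open import Data.List.Membership.Propositional.Properties using (∈-map⁺; ∈-map⁻)
  open import Data.List.Relation.Unary.All as All using ([]; _∷_)
  open import Data.List.Relation.Unary.AllPairs using ([]; _∷_)
  open import Data.List.Relation.Unary.Unique.Propositional using (Unique)
  open import Data.List.Relation.Unary.Unique.Propositional.Properties using (map⁺)
  open import Data.Vec as V using ([]; _∷_)
  open import Data.Product using (∃; _×_; _,_; proj₁; proj₂)
  open import Relation.Nullary using (Dec; yes; no; contradiction)
  open import Relation.Nullary.Decidable using (¬?; decidable-stable; _×-dec_)
  open import Relation.Unary using (Decidable)
  open import Relation.Binary.PropositionalEquality using (_≡_; _≢_; refl; sym; trans; cong; cong₂; subst; subst₂; module ≡-Reasoning)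
  open import Algebra.Bundles using (CommutativeRing)

  open LinAlg F
  open Matrices F
  open CommutativeRing ring using (*-comm)
  open Counting
  open Enumeration
  open ≡-Reasoning

  private variable
    k m n : ℕ

  field-enumeration : Enumeration Carrier
  field-enumeration = record { elements = elems ; ∈-elements = complete ; elements-unique = unique ; decEq = _≟_ }

  vect-enumeration : ∀ n → Enumeration (Vect n)
  vect-enumeration = vec-enumeration field-enumeration

  mat-enumeration : ∀ m n → Enumeration (Mat m n)
  mat-enumeration m n = vec-enumeration (vect-enumeration n) m

  private
    _∈?_ : (v : Vect n) (vs : List (Vect n)) → Dec (v ∈ vs)
    v ∈? vs = any? (vect? v) vs

  image : Mat n k → List (Vect n)
  image {k = k} ι = map (ι ·_) (allVects k)

  ∈-image : (ι : Mat n k) (x : Vect k) → ι · x ∈ image ι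
  ∈-image ι x = ∈-map⁺ (ι ·_) (∈-elements (vect-enumeration _) x)

  image-unique : (ι : Mat n k) → Injective ι → Unique (image ι)
  image-unique ι ι! = map⁺ (Injective⇒·-injective ι!) (elements-unique (vect-enumeration _))

  length-image : (ι : Mat n k) → length (image ι) ≡ N k
  length-image {k = k} ι = length-map (ι ·_) (allVects k)

  N-strictMono : k < n → N k < N n
  N-strictMono {k} {n} k<n =
    subst₂ _<_ (sym (length-allVecs elems k)) (sym (length-allVecs elems n)) (^-monoʳ-< (length elems) 1<q k<n)
    where
    1<q : 1 < length elems
    1<q = unique⊆⇒length≤ ((0≢1 ∷ []) ∷ [] ∷ []) (λ {x} _ → complete x)

  injective-misses-vector : (ι : Mat n k) → Injective ι → k < n → ∃ λ v → ∀ x → ι · x ≢ v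
  injective-misses-vector {n} ι ι! k<n with searchVect n (λ v → ¬? (v ∈? image ι))
  ... | yes (v , v∉) = v , λ x ιx≡v → v∉ (subst (_∈ image ι) ιx≡v (∈-image ι x))
  ... | no  ∄v       = contradiction (<-≤-trans (N-strictMono k<n)
         (subst (N n ≤_) (length-image ι) (unique⊆⇒length≤ (elements-unique (vect-enumeration n)) all∈image))) (<-irrefl refl)
    where
    all∈image : ∀ {v} → v ∈ allVects n → v ∈ image ι
    all∈image {v} _ = decidable-stable (v ∈? image ι) (λ v∉ → ∄v (v , v∉))

  injective-surjective : (G : Mat n n) → Injective G → ∀ y → ∃ λ x → G · x ≡ y
  injective-surjective {n} G G! y with y ∈? image G
  ... | yes y∈ with x , _ , y≡Gx ← ∈-map⁻ (G ·_) y∈ = x , sym y≡Gx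
  ... | no  y∉ = contradiction (subst (_≤ N n) (cong suc (length-image G))
         (unique⊆⇒length≤ (All.tabulate (λ z∈ y≡z → y∉ (subst (_∈ image G) (sym y≡z) z∈)) ∷ image-unique G G!)
                          (λ {v} _ → ∈-elements (vect-enumeration n) v))) (<-irrefl refl)

  Injective⇒Invertible : (G : Mat n n) → Injective G → Invertible G
  Injective⇒Invertible {n} G G! =
    G⁻¹ , matrix-ext _ _ (λ v → trans (⊗-· G G⁻¹ v) (trans (GG⁻¹ v) (sym (idMat-· v))))
        , matrix-ext _ _ (λ v → trans (⊗-· G⁻¹ G v) (trans (Injective⇒·-injective G! (GG⁻¹ (G · v))) (sym (idMat-· v))))
    where
    lift = lift-through-injective G G! (λ v → v) ((λ _ _ → refl) , (λ _ _ → refl)) (injective-surjective G G!)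
    G⁻¹ = proj₁ lift
    GG⁻¹ = proj₂ lift

  consColumn : Vect n → Mat n k → Mat n (suc k)
  consColumn = V.zipWith _∷_

  consColumn-· : (v : Vect n) (ι : Mat n k) (c : Carrier) (x : Vect k) → consColumn v ι · (c ∷ x) ≡ c • v +ᵥ ι · x
  consColumn-· []      []      c x = refl
  consColumn-· (a ∷ v) (r ∷ ι) c x = cong₂ _∷_ (cong (_+ dot r x) (*-comm a c)) (consColumn-· v ι c x)

  consColumn-injective : (v : Vect n) (ι : Mat n k) → Injective ι → (∀ x → ι · x ≢ v) → Injective (consColumn v ι)
  consColumn-injective v ι ι! v∉ι (c ∷ x) e with c ≟ 0#
  ... | yes refl = cong (0# ∷_) (ι! x (trans (sym (0•+ᵥ v (ι · x))) (trans (sym (consColumn-· v ι 0# x)) e)))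
  ... | no  c≢0  with c⁻¹ , cc⁻¹ ← inverse c c≢0 = contradiction
        (trans (·-• ι (- c⁻¹) x) (sym (c•v+w≡0⇒v≡-c⁻¹•w cc⁻¹ v (ι · x) (trans (sym (consColumn-· v ι c x)) e))))
        (v∉ι ((- c⁻¹) • x))

  shift : ∀ k → Mat (suc k) k
  shift k = zeroV k ∷ idMat k

  shift-· : (x : Vect k) → shift k · x ≡ 0# ∷ x
  shift-· x = cong₂ _∷_ (dot-zeroˡ x) (idMat-· x)

  shift-injective : Injective (shift k)
  shift-injective x shiftx≡0 = cong V.tail (trans (sym (shift-· x)) shiftx≡0)

  consColumn-⊗-shift : (v : Vect n) (ι : Mat n k) → consColumn v ι ⊗ shift k ≡ ι
  consColumn-⊗-shift v ι = matrix-ext _ _ λ x → begin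
    (consColumn v ι ⊗ shift _) · x ≡⟨ ⊗-· (consColumn v ι) (shift _) x ⟩
    consColumn v ι · (shift _ · x) ≡⟨ cong (consColumn v ι ·_) (shift-· x) ⟩
    consColumn v ι · (0# ∷ x)      ≡⟨ consColumn-· v ι 0# x ⟩
    0# • v +ᵥ ι · x                ≡⟨ 0•+ᵥ v (ι · x) ⟩
    ι · x                          ∎

  -- The inclusion F^k → F^(m + k), x ↦ (0, …, 0, x).
  embedding : ∀ n m k → m ℕ.+ k ≡ n → Mat n k
  embedding n zero    k refl = idMat k
  embedding n (suc m) k eq   = embedding n m (suc k) (trans (+-suc m k) eq) ⊗ shift k

  embedding-injective : ∀ n m k (eq : m ℕ.+ k ≡ n) → Injective (embedding n m k eq)
  embedding-injective n zero    k refl x idx≡0 = trans (sym (idMat-· x)) idx≡0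
  embedding-injective n (suc m) k eq =
    Injective-⊗ _ (shift k) (embedding-injective n m (suc k) (trans (+-suc m k) eq)) shift-injective

  -- Adjoin vectors outside the image as new first columns until the matrix is square.
  extend-to-injective : ∀ m k (eq : m ℕ.+ k ≡ n) (ι : Mat n k) → Injective ι →
    ∃ λ (G : Mat n n) → Injective G × G ⊗ embedding n m k eq ≡ ι
  extend-to-injective zero    k refl ι ι! = ι , ι! , ⊗-identityʳ ι
  extend-to-injective {n} (suc m) k eq ι ι!
    with v , v∉ι ← injective-misses-vector ι ι! (subst (suc k ≤_) eq (s≤s (m≤n+m k m)))
    with G , G! , G⊗E≡vι ← extend-to-injective m (suc k) (trans (+-suc m k) eq) (consColumn v ι) (consColumn-injective v ι ι! v∉ι)
    = G , G! , (begin
      G ⊗ (E ⊗ shift k)             ≡⟨ sym (⊗-assoc G E (shift k)) ⟩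
      (G ⊗ E) ⊗ shift k             ≡⟨ cong (_⊗ shift k) G⊗E≡vι ⟩
      consColumn v ι ⊗ shift k      ≡⟨ consColumn-⊗-shift v ι ⟩
      ι                             ∎)
    where E = embedding n m (suc k) (trans (+-suc m k) eq)

  standardEmbedding : k ≤ n → Mat n k
  standardEmbedding {k} {n} k≤n = embedding n (n ∸ k) k (m∸n+n≡m k≤n)

  standardEmbedding-injective : (k≤n : k ≤ n) → Injective (standardEmbedding k≤n)
  standardEmbedding-injective {k} {n} k≤n = embedding-injective n (n ∸ k) k (m∸n+n≡m k≤n)

  extend-to-invertible : (k≤n : k ≤ n) (ι : Mat n k) → Injective ι → ∃ λ (G : Mat n n) → Invertible G × G ⊗ standardEmbedding k≤n ≡ ι
  extend-to-invertible {k} {n} k≤n ι ι! with G , G! , GE≡ι ← extend-to-injective (n ∸ k) k (m∸n+n≡m k≤n) ι ι! =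
    G , Injective⇒Invertible G G! , GE≡ι

  Carries : Mat n k → Mat n k → Mat n n → Set
  Carries ι₁ ι₂ T = Invertible T × T ⊗ ι₁ ≡ ι₂

  carries? : (ι₁ ι₂ : Mat n k) → Decidable (Carries ι₁ ι₂)
  carries? ι₁ ι₂ T = invertible? T ×-dec mat? (T ⊗ ι₁) ι₂

  count-carries-⊗ʳ : (ι₁ ι₂ : Mat n k) (a : Mat n n) → Invertible a →
    count (carries? ι₁ ι₂) (allMats n n) ≡ count (carries? (a ⊗ ι₁) ι₂) (allMats n n)
  count-carries-⊗ʳ {n} ι₁ ι₂ a a-inv@(a⁻¹ , aa⁻¹ , a⁻¹a) = count-bijection (carries? ι₁ ι₂) (carries? (a ⊗ ι₁) ι₂)
    (mat-enumeration n n) (mat-enumeration n n) (_⊗ a⁻¹) (_⊗ a)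
    (λ {T} (T-inv , Tι₁≡ι₂) → Invertible-⊗ T a⁻¹ T-inv (Invertible-inverse a a-inv) ,
                              trans (⊗-cancel-middle T a⁻¹ a ι₁ a⁻¹a) Tι₁≡ι₂)
    (λ {S} (S-inv , Saι₁≡ι₂) → Invertible-⊗ S a S-inv a-inv , trans (⊗-assoc S a ι₁) Saι₁≡ι₂)
    (λ {T} _ → ⊗-cancelʳ-inverse T a⁻¹ a a⁻¹a)
    (λ {S} _ → ⊗-cancelʳ-inverse S a a⁻¹ aa⁻¹)

  count-carries-⊗ˡ : (ι₁ ι₂ : Mat n k) (b : Mat n n) → Invertible b →
    count (carries? ι₁ ι₂) (allMats n n) ≡ count (carries? ι₁ (b ⊗ ι₂)) (allMats n n)
  count-carries-⊗ˡ {n} ι₁ ι₂ b b-inv@(b⁻¹ , bb⁻¹ , b⁻¹b) = count-bijection (carries? ι₁ ι₂) (carries? ι₁ (b ⊗ ι₂))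
    (mat-enumeration n n) (mat-enumeration n n) (b ⊗_) (b⁻¹ ⊗_)
    (λ {T} (T-inv , Tι₁≡ι₂) → Invertible-⊗ b T b-inv T-inv , trans (⊗-assoc b T ι₁) (cong (b ⊗_) Tι₁≡ι₂))
    (λ {S} (S-inv , Sι₁≡bι₂) → Invertible-⊗ b⁻¹ S (Invertible-inverse b b-inv) S-inv ,
                               trans (⊗-assoc b⁻¹ S ι₁) (trans (cong (b⁻¹ ⊗_) Sι₁≡bι₂) (⊗-cancelˡ-inverse b⁻¹ b ι₂ b⁻¹b)))
    (λ {T} _ → ⊗-cancelˡ-inverse b⁻¹ b T b⁻¹b)
    (λ {S} _ → ⊗-cancelˡ-inverse b b⁻¹ S bb⁻¹)

  count-carries : (k≤n : k ≤ n) (ι₁ ι₂ : Mat n k) → Injective ι₁ → Injective ι₂ →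
    count (carries? ι₁ ι₂) (allMats n n) ≡ count (carries? (standardEmbedding k≤n) (standardEmbedding k≤n)) (allMats n n)
  count-carries k≤n ι₁ ι₂ ι₁! ι₂!
    with a , a-inv , aε≡ι₁ ← extend-to-invertible k≤n ι₁ ι₁!
       | b , b-inv , bε≡ι₂ ← extend-to-invertible k≤n ι₂ ι₂! = begin
    count (carries? ι₁ ι₂) mats              ≡⟨ cong₂ (λ ι ι′ → count (carries? ι ι′) mats) (sym aε≡ι₁) (sym bε≡ι₂) ⟩
    count (carries? (a ⊗ ε) (b ⊗ ε)) mats    ≡⟨ sym (count-carries-⊗ʳ ε (b ⊗ ε) a a-inv) ⟩
    count (carries? ε (b ⊗ ε)) mats          ≡⟨ sym (count-carries-⊗ˡ ε ε b b-inv) ⟩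
    count (carries? ε ε) mats                ∎
    where
    ε = standardEmbedding k≤n
    mats = allMats _ _

module Subspaces (F : FiniteField) where

  open import Data.Bool using (true; false)
  open import Data.Fin as Fin using (Fin)
  open import Data.List as L using (List; _∷_)
  open import Data.List.Membership.Propositional.Properties using (∈-lookup)
  import Data.List.Relation.Unary.All as All
  open import Data.List.Relation.Unary.AllPairs using (_∷_)
  import Data.List.Relation.Unary.Any as Any
  open import Data.List.Relation.Unary.Any.Properties using (lookup-index)
  open import Data.List.Relation.Unary.Unique.Propositional using (Unique)
  import Data.Vec as V
  open import Data.Vec.Properties using (lookup∘tabulate; tabulate∘lookup; tabulate-cong)
  open import Data.Product using (∃; _×_; _,_; proj₁; proj₂)
  open import Relation.Nullary using (Dec; yes; does; contradiction)
  open import Relation.Nullary.Decidable using (dec-true)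
  open import Function using (_∘_)
  open import Relation.Binary.PropositionalEquality using (_≡_; refl; sym; trans; cong; subst)

  open LinAlg F
  open Matrices F
  open InjectiveMatrices F
  open Counting
  open Enumeration

  private variable
    k n : ℕ

  lookup-injective : {A : Set} {xs : List A} → Unique xs → ∀ i j → L.lookup xs i ≡ L.lookup xs j → i ≡ j
  lookup-injective {xs = _ ∷ _} _         Fin.zero    Fin.zero    _ = refl
  lookup-injective {xs = _ ∷ _} (x∉ ∷ _)  Fin.zero    (Fin.suc j) e = contradiction e (All.lookup x∉ (∈-lookup j))
  lookup-injective {xs = _ ∷ _} (x∉ ∷ _)  (Fin.suc i) Fin.zero    e = contradiction (sym e) (All.lookup x∉ (∈-lookup i))
  lookup-injective {xs = _ ∷ _} (_ ∷ xs!) (Fin.suc i) (Fin.suc j) e = cong Fin.suc (lookup-injective xs! i j e)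

  ∈W-ext : (W W' : SubsetV n) → (∀ v → v ∈W W → v ∈W W') → (∀ v → v ∈W W' → v ∈W W) → W ≡ W'
  ∈W-ext {n} W W' W⊆W' W'⊆W = trans (sym (tabulate∘lookup W)) (trans (tabulate-cong same-bit) (tabulate∘lookup W'))
    where
    bit-⊆ : ∀ (U U' : SubsetV n) → (∀ v → v ∈W U → v ∈W U') → ∀ i → V.lookup U i ≡ true → V.lookup U' i ≡ true
    bit-⊆ U U' U⊆U' i Ui with j , vj≡vi , U'j ← U⊆U' _ (i , refl , Ui) =
      subst (λ j → V.lookup U' j ≡ true) (lookup-injective (elements-unique (vect-enumeration n)) j i vj≡vi) U'j
    same-bit : ∀ i → V.lookup W i ≡ V.lookup W' i
    same-bit i with V.lookup W i in Wi | V.lookup W' i in W'i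
    ... | true  | true  = refl
    ... | false | false = refl
    ... | true  | false = trans (sym (bit-⊆ W W' W⊆W' i Wi)) W'i
    ... | false | true  = trans (sym Wi) (bit-⊆ W' W W'⊆W i W'i)

  private
    hits? : (ι : Mat n k) (i : Fin (N n)) → Dec (∃ λ x → ι · x ≡ L.lookup (allVects n) i)
    hits? {n} {k} ι i = searchVect k (λ x → vect? (ι · x) (L.lookup (allVects n) i))

    does≡true⇒ : {X : Set} (x? : Dec X) → does x? ≡ true → X
    does≡true⇒ (yes x) _ = x

  columnSpace : Mat n k → SubsetV n
  columnSpace ι = V.tabulate (does ∘ hits? ι)

  ∈-columnSpace⁻ : (ι : Mat n k) {v : Vect n} → v ∈W columnSpace ι → ∃ λ x → ι · x ≡ v
  ∈-columnSpace⁻ ι (i , vi≡v , ∈ι) with x , ιx≡vi ← does≡true⇒ (hits? ι i) (trans (sym (lookup∘tabulate _ i)) ∈ι) =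
    x , trans ιx≡vi vi≡v

  ∈-columnSpace⁺ : (ι : Mat n k) {v : Vect n} → (∃ λ x → ι · x ≡ v) → v ∈W columnSpace ι
  ∈-columnSpace⁺ {n} ι {v} (x , ιx≡v) =
    i , sym v≡vi , trans (lookup∘tabulate _ i) (dec-true (hits? ι i) (x , trans ιx≡v v≡vi))
    where
    v∈ = ∈-elements (vect-enumeration n) v
    i = Any.index v∈
    v≡vi = lookup-index v∈

  columnSpace-unique : (ι : Mat n k) (W : SubsetV n) → (∀ v → v ∈W W ⇔ (∃ λ x → ι · x ≡ v)) → columnSpace ι ≡ W
  columnSpace-unique ι W W≡im = ∈W-ext _ _ (λ v → proj₂ (W≡im v) ∘ ∈-columnSpace⁻ ι) (λ v → ∈-columnSpace⁺ ι ∘ proj₁ (W≡im v))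

  columnSpace-⊗-invertible : (ι : Mat n k) (g : Mat k k) → Invertible g → columnSpace (ι ⊗ g) ≡ columnSpace ι
  columnSpace-⊗-invertible ι g (g⁻¹ , gg⁻¹ , _) = ∈W-ext _ _
    (λ v v∈ → let x , ιgx≡v = ∈-columnSpace⁻ (ι ⊗ g) v∈ in
      ∈-columnSpace⁺ ι (g · x , trans (sym (⊗-· ι g x)) ιgx≡v))
    (λ v v∈ → let y , ιy≡v = ∈-columnSpace⁻ ι v∈ in
      ∈-columnSpace⁺ (ι ⊗ g) (g⁻¹ · y , trans (⊗-· ι g _) (trans (cong (ι ·_) (·-inverse g g⁻¹ gg⁻¹ y)) ιy≡v)))

  same-columnSpace⇒⊗-invertible : (ι₀ ι : Mat n k) → Injective ι₀ → Injective ι → columnSpace ι₀ ≡ columnSpace ι →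
    ∃ λ g → Invertible g × ι₀ ⊗ g ≡ ι
  same-columnSpace⇒⊗-invertible ι₀ ι ι₀! ι! im≡ = g , (h , gh≡1 , hg≡1) , ι₀g≡ι
    where
    factor : (ι₁ ι₂ : Mat n k) → Injective ι₁ → columnSpace ι₂ ≡ columnSpace ι₁ → ∃ λ g → ι₁ ⊗ g ≡ ι₂
    factor ι₁ ι₂ ι₁! im≡′ with g , ι₁g≗ι₂ ← lift-through-injective ι₁ ι₁! (ι₂ ·_) (·-isLinear ι₂)
                              (λ y → ∈-columnSpace⁻ ι₁ (subst (ι₂ · y ∈W_) im≡′ (∈-columnSpace⁺ ι₂ (y , refl)))) =
      g , matrix-ext _ _ (λ v → trans (⊗-· ι₁ g v) (ι₁g≗ι₂ v))
    g = proj₁ (factor ι₀ ι ι₀! (sym im≡))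
    ι₀g≡ι = proj₂ (factor ι₀ ι ι₀! (sym im≡))
    h = proj₁ (factor ι ι₀ ι! im≡)
    ιh≡ι₀ = proj₂ (factor ι ι₀ ι! im≡)
    gh≡1 : g ⊗ h ≡ idMat _
    gh≡1 = Injective⇒⊗-cancelˡ ι₀ ι₀! _ _ (trans (sym (⊗-assoc ι₀ g h)) (trans (cong (_⊗ h) ι₀g≡ι) (trans ιh≡ι₀ (sym (⊗-identityʳ ι₀)))))
    hg≡1 : h ⊗ g ≡ idMat _
    hg≡1 = Injective⇒⊗-cancelˡ ι ι! _ _ (trans (sym (⊗-assoc ι h g)) (trans (cong (_⊗ g) ιh≡ι₀) (trans ι₀g≡ι (sym (⊗-identityʳ ι)))))

module DoubleCounting (F : FiniteField) {d : ℕ} (A₀ : LinAlg.Mat F d d) (A₀-inv : LinAlg.Invertible F A₀) (n : ℕ) (d≤n : d ≤ n) where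

  import Data.Nat as ℕ
  open import Data.Product using (∃; _×_; _,_; proj₁; proj₂)
  open import Relation.Nullary.Decidable using (_×-dec_)
  open import Relation.Unary using (Decidable)
  open import Relation.Binary.PropositionalEquality using (_≡_; refl; sym; trans; cong; cong₂; subst; module ≡-Reasoning)

  open LinAlg F
  open Matrices F
  open InjectiveMatrices F
  open Subspaces F
  open Counting
  open Enumeration
  open ≡-Reasoning

  subspace-pairs : Enumeration (Mat n n × SubsetV n)
  subspace-pairs = ×-enumeration (mat-enumeration n n) (vec-enumeration bool-enumeration (N n))

  embedding-pairs : Enumeration (Mat n n × Mat n d)
  embedding-pairs = ×-enumeration (mat-enumeration n n) (mat-enumeration n d)

  StableSubspace : Mat n n × SubsetV n → Set
  StableSubspace (T , W) = Invertible T × Good A₀ T W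

  stableSubspace? : Decidable StableSubspace
  stableSubspace? (T , W) = invertible? T ×-dec good? A₀ T W

  sumX≡count-stableSubspaces : sumX A₀ n ≡ count stableSubspace? (elements subspace-pairs)
  sumX≡count-stableSubspaces = sum-count-filter invertible? (good? A₀) (allMats n n) (allSubsets n)

  StableEmbedding : Mat n n × Mat n d → Set
  StableEmbedding (T , ι) = Invertible T × Injective ι × ∃ λ A → InClass A₀ A × T ⊗ ι ≡ ι ⊗ A

  stableEmbedding? : Decidable StableEmbedding
  stableEmbedding? (T , ι) = invertible? T ×-dec injective? ι ×-dec searchMat d d (λ A → inClass? A₀ A ×-dec mat? (T ⊗ ι) (ι ⊗ A))

  spanned : Mat n n × Mat n d → Mat n n × SubsetV n
  spanned (T , ι) = T , columnSpace ι

  columnSpace-stable : (T : Mat n n) (ι : Mat n d) (A : Mat d d) → Invertible A → T ⊗ ι ≡ ι ⊗ A →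
    ∀ v → v ∈W columnSpace ι ⇔ (∃ λ u → u ∈W columnSpace ι × T · u ≡ v)
  columnSpace-stable T ι A (A⁻¹ , AA⁻¹ , _) Tι≡ιA v =
      (λ v∈ → let x , ιx≡v = ∈-columnSpace⁻ ι v∈ in
         ι · (A⁻¹ · x) , ∈-columnSpace⁺ ι (A⁻¹ · x , refl) ,
         trans (Tι· (A⁻¹ · x)) (trans (cong (ι ·_) (·-inverse A A⁻¹ AA⁻¹ x)) ιx≡v))
    , (λ (u , u∈ , Tu≡v) → let x , ιx≡u = ∈-columnSpace⁻ ι u∈ in
         ∈-columnSpace⁺ ι (A · x , trans (sym (Tι· x)) (trans (cong (T ·_) ιx≡u) Tu≡v)))
    where
    Tι· : ∀ x → T · (ι · x) ≡ ι · (A · x)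
    Tι· x = trans (⊗≡⇒·≡ Tι≡ιA x) (⊗-· ι A x)

  stableEmbedding⇒stableSubspace : ∀ {p} → StableEmbedding p → StableSubspace (spanned p)
  stableEmbedding⇒stableSubspace {T , ι} (T-inv , ι! , A , A∈C , Tι≡ιA) =
    T-inv , columnSpace-stable T ι A (InClass⇒Invertible A₀-inv A∈C) Tι≡ιA ,
    ι , ι! , (λ v → ∈-columnSpace⁻ ι , ∈-columnSpace⁺ ι) , A , A∈C , Tι≡ιA

  count-stableEmbeddings-spanning : ∀ {TW} → StableSubspace TW →
    count (fibre? stableEmbedding? (decEq subspace-pairs) spanned TW) (elements embedding-pairs) ≡ cardGL d
  count-stableEmbeddings-spanning {T , W} (T-inv , _ , ι₀ , ι₀! , W≡im , A , A∈C , Tι₀≡ι₀A) =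
    count-bijection (fibre? stableEmbedding? (decEq subspace-pairs) spanned (T , W)) invertible?
      embedding-pairs (mat-enumeration d d) (λ p → ι₀ \\ proj₂ p) (λ g → T , ι₀ ⊗ g) to-GL from-GL from∘to to∘from
    where
    columnSpace-ι₀ : columnSpace ι₀ ≡ W
    columnSpace-ι₀ = columnSpace-unique ι₀ W W≡im
    factor : ∀ {ι} → Injective ι → columnSpace ι ≡ W → ∃ λ g → Invertible g × ι₀ ⊗ g ≡ ι
    factor ι! im≡W = same-columnSpace⇒⊗-invertible ι₀ _ ι₀! ι! (trans columnSpace-ι₀ (sym im≡W))
    to-GL : ∀ {p} → StableEmbedding p × spanned p ≡ (T , W) → Invertible (ι₀ \\ proj₂ p)
    to-GL {_ , ι} ((_ , ι! , _) , eq) =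
      let g , g-inv , ι₀g≡ι = factor ι! (cong proj₂ eq) in subst Invertible (sym (\\-unique ι₀ ι₀! g ι₀g≡ι)) g-inv
    from-GL : ∀ {g} → Invertible g → StableEmbedding (T , ι₀ ⊗ g) × spanned (T , ι₀ ⊗ g) ≡ (T , W)
    from-GL {g} g-inv@(h , gh≡1 , hg≡1) =
      (T-inv , Injective-⊗ ι₀ g ι₀! (Invertible⇒Injective g g-inv) ,
       (h ⊗ A) ⊗ g , InClass-conjugate A₀ A g h gh≡1 hg≡1 A∈C , ⊗-intertwine T ι₀ A g h Tι₀≡ι₀A gh≡1) ,
      cong (T ,_) (trans (columnSpace-⊗-invertible ι₀ g g-inv) columnSpace-ι₀)
    from∘to : ∀ {p} → StableEmbedding p × spanned p ≡ (T , W) → (T , ι₀ ⊗ (ι₀ \\ proj₂ p)) ≡ p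
    from∘to {_ , ι} ((_ , ι! , _) , eq) =
      let g , _ , ι₀g≡ι = factor ι! (cong proj₂ eq)
      in cong₂ _,_ (cong proj₁ (sym eq)) (trans (cong (ι₀ ⊗_) (\\-unique ι₀ ι₀! g ι₀g≡ι)) ι₀g≡ι)
    to∘from : ∀ {g} → Invertible g → ι₀ \\ (ι₀ ⊗ g) ≡ g
    to∘from {g} _ = \\-unique ι₀ ι₀! g refl

  count-stableEmbeddings-by-span : count stableEmbedding? (elements embedding-pairs) ≡ count stableSubspace? (elements subspace-pairs) ℕ.* cardGL d
  count-stableEmbeddings-by-span = count-by-fibres stableEmbedding? stableSubspace? subspace-pairs spanned (elements embedding-pairs) (cardGL d)
    stableEmbedding⇒stableSubspace count-stableEmbeddings-spanning

  Intertwiner : Mat n n × Mat n d → Set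
  Intertwiner (T , ι) = Invertible T × Injective ι × T ⊗ ι ≡ ι ⊗ A₀

  intertwiner? : Decidable Intertwiner
  intertwiner? (T , ι) = invertible? T ×-dec injective? ι ×-dec mat? (T ⊗ ι) (ι ⊗ A₀)

  -- The matrix of T restricted to the image of ι, in the basis given by the columns of ι.
  restriction : Mat n n × Mat n d → Mat d d
  restriction p = proj₂ p \\ (proj₁ p ⊗ proj₂ p)

  restriction-∈C : ∀ {p} → StableEmbedding p → InClass A₀ (restriction p)
  restriction-∈C {T , ι} (_ , ι! , A , A∈C , Tι≡ιA) = subst (InClass A₀) (sym (\\-unique ι ι! A (sym Tι≡ιA))) A∈C

  count-stableEmbeddings-restricting-to : ∀ {A} → InClass A₀ A →
    count (fibre? stableEmbedding? (decEq (mat-enumeration d d)) restriction A) (elements embedding-pairs)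
    ≡ count intertwiner? (elements embedding-pairs)
  count-stableEmbeddings-restricting-to {A} (u , w , uw≡1 , wu≡1 , A≡uA₀w) =
    count-bijection (fibre? stableEmbedding? (decEq (mat-enumeration d d)) restriction A) intertwiner? embedding-pairs embedding-pairs
      (λ p → proj₁ p , proj₂ p ⊗ u) (λ p → proj₁ p , proj₂ p ⊗ w) to from from∘to to∘from
    where
    to : ∀ {p} → StableEmbedding p × restriction p ≡ A → Intertwiner (proj₁ p , proj₂ p ⊗ u)
    to {T , ι} ((T-inv , ι! , A′ , _ , Tι≡ιA′) , restriction≡A) =
      T-inv , Injective-⊗ ι u ι! (Invertible⇒Injective u (w , uw≡1 , wu≡1)) , (begin
        T ⊗ (ι ⊗ u)                            ≡⟨ ⊗-intertwine T ι A u w Tι≡ιA uw≡1 ⟩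
        (ι ⊗ u) ⊗ ((w ⊗ A) ⊗ u)                ≡⟨ cong (λ B → (ι ⊗ u) ⊗ ((w ⊗ B) ⊗ u)) A≡uA₀w ⟩
        (ι ⊗ u) ⊗ ((w ⊗ ((u ⊗ A₀) ⊗ w)) ⊗ u)   ≡⟨ cong ((ι ⊗ u) ⊗_) (conjugate-cancel A₀ u w wu≡1) ⟩
        (ι ⊗ u) ⊗ A₀                           ∎)
      where
      Tι≡ιA : T ⊗ ι ≡ ι ⊗ A
      Tι≡ιA = trans Tι≡ιA′ (cong (ι ⊗_) (trans (sym (\\-unique ι ι! A′ (sym Tι≡ιA′))) restriction≡A))
    from : ∀ {p} → Intertwiner p → StableEmbedding (proj₁ p , proj₂ p ⊗ w) × restriction (proj₁ p , proj₂ p ⊗ w) ≡ A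
    from {T , ι} (T-inv , ι! , Tι≡ιA₀) =
      (T-inv , ιw! , A , (u , w , uw≡1 , wu≡1 , A≡uA₀w) , Tιw≡ιwA) , \\-unique (ι ⊗ w) ιw! A (sym Tιw≡ιwA)
      where
      ιw! = Injective-⊗ ι w ι! (Invertible⇒Injective w (u , wu≡1 , uw≡1))
      Tιw≡ιwA : T ⊗ (ι ⊗ w) ≡ (ι ⊗ w) ⊗ A
      Tιw≡ιwA = trans (⊗-intertwine T ι A₀ w u Tι≡ιA₀ wu≡1) (cong ((ι ⊗ w) ⊗_) (sym A≡uA₀w))
    from∘to : ∀ {p} → StableEmbedding p × restriction p ≡ A → (proj₁ p , (proj₂ p ⊗ u) ⊗ w) ≡ p
    from∘to {T , ι} _ = cong (T ,_) (⊗-cancelʳ-inverse ι u w uw≡1)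
    to∘from : ∀ {p} → Intertwiner p → (proj₁ p , (proj₂ p ⊗ w) ⊗ u) ≡ p
    to∘from {T , ι} _ = cong (T ,_) (⊗-cancelʳ-inverse ι w u wu≡1)

  count-stableEmbeddings-by-restriction : count stableEmbedding? (elements embedding-pairs) ≡ cardClass A₀ ℕ.* count intertwiner? (elements embedding-pairs)
  count-stableEmbeddings-by-restriction = count-by-fibres stableEmbedding? (inClass? A₀) (mat-enumeration d d) restriction
    (elements embedding-pairs) (count intertwiner? (elements embedding-pairs)) restriction-∈C count-stableEmbeddings-restricting-to

  ε : Mat n d
  ε = standardEmbedding d≤n

  stabiliser-size : ℕ
  stabiliser-size = count (carries? ε ε) (allMats n n)

  count-intertwiners-through : ∀ {ι} → Injective ι →
    count (fibre? intertwiner? (decEq (mat-enumeration n d)) proj₂ ι) (elements embedding-pairs) ≡ stabiliser-size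
  count-intertwiners-through {ι} ι! = trans
    (count-bijection (fibre? intertwiner? (decEq (mat-enumeration n d)) proj₂ ι) (carries? ι (ι ⊗ A₀))
      embedding-pairs (mat-enumeration n n) proj₁ (λ T → T , ι)
      (λ { {T , ι′} ((T-inv , _ , Tι≡ιA₀) , refl) → T-inv , Tι≡ιA₀ })
      (λ (T-inv , Tι≡ιA₀) → (T-inv , ι! , Tι≡ιA₀) , refl)
      (λ { (_ , refl) → refl })
      (λ _ → refl))
    (count-carries d≤n ι (ι ⊗ A₀) ι! (Injective-⊗ ι A₀ ι! (Invertible⇒Injective A₀ A₀-inv)))

  count-intertwiners : count intertwiner? (elements embedding-pairs) ≡ count injective? (allMats n d) ℕ.* stabiliser-size
  count-intertwiners = count-by-fibres intertwiner? injective? (mat-enumeration n d) proj₂ (elements embedding-pairs) stabiliser-size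
    (λ (_ , ι! , _) → ι!) count-intertwiners-through

  cardGL≡count-injective*stabiliser-size : cardGL n ≡ count injective? (allMats n d) ℕ.* stabiliser-size
  cardGL≡count-injective*stabiliser-size = count-by-fibres invertible? injective? (mat-enumeration n d) (_⊗ ε) (allMats n n) stabiliser-size
    (λ {T} T-inv → Injective-⊗ T ε (Invertible⇒Injective T T-inv) (standardEmbedding-injective d≤n))
    (λ {ι} ι! → count-carries d≤n ε ι (standardEmbedding-injective d≤n) ι!)

open import Data.Nat using (_*_)
open import Relation.Binary.PropositionalEquality using (_≡_; sym; cong; module ≡-Reasoning)

theorem1p1 : (F : FiniteField) (d : ℕ) → 1 ≤ d →
    (A₀ : LinAlg.Mat F d d) → LinAlg.Invertible F A₀ →
    (n : ℕ) → d ≤ n →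
    LinAlg.sumX F A₀ n * LinAlg.cardGL F d ≡ LinAlg.cardClass F A₀ * LinAlg.cardGL F n
theorem1p1 F d _ A₀ A₀-inv n d≤n = begin
  sumX A₀ n * cardGL d                                          ≡⟨ cong (_* cardGL d) sumX≡count-stableSubspaces ⟩
  count stableSubspace? (elements subspace-pairs) * cardGL d    ≡⟨ sym count-stableEmbeddings-by-span ⟩
  count stableEmbedding? (elements embedding-pairs)             ≡⟨ count-stableEmbeddings-by-restriction ⟩
  cardClass A₀ * count intertwiner? (elements embedding-pairs)  ≡⟨ cong (cardClass A₀ *_) count-intertwiners ⟩
  cardClass A₀ * (count injective? (allMats n d) * stabiliser-size)
                                                                ≡⟨ cong (cardClass A₀ *_) (sym cardGL≡count-injective*stabiliser-size) ⟩
  cardClass A₀ * cardGL n                                       ∎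
  where
  open LinAlg F using (sumX; cardGL; cardClass; allMats)
  open Counting.Enumeration
  open Matrices F using (injective?)
  open DoubleCounting F A₀ A₀-inv n d≤n
  open ≡-Reasoning
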